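{- Let $G$ be a finite simple graph on $n\geq 2$ vertices with minimum degree $\delta(G)$, and let $k\geq 2$ be an integer. Then $C_{k}(G)\geq \delta(G)-k+3$. Moreover, this bound is sharp: for every $n$ and every integer $k$ with $2\leq k\leq n-1$, the complete graph $K_n$ satisfies $C_k(K_n)=\delta(K_n)-k+3=n-k+2$.
   Context: All graphs are finite and simple. For a positive integer $k$, a set $S\subseteq V(G)$ is a $k$-dominating set of $G$ if every vertex $v\in V(G)\setminus S$ has at least $k$ neighbors in $S$. Two disjoint sets $A,B\subseteq V(G)$ form a $k$-coalition if neither $A$ nor $B$ is a $k$-dominating set of $G$ but $A\cup B$ is a $k$-dominating set of $G$. A $k$-coalition partition of $G$ is a partition $\Theta$ of $V(G)$ such that every set in $\Theta$ is either a $k$-dominating set of cardinality $k$ or forms a $k$-coalition with another set of $\Theta$. The $k$-coalition number $C_k(G)$ is the maximum cardinality of a $k$-coalition partition of $G$. -}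

module Defs where

open import Data.Nat using (ℕ; zero; suc; _+_; _≤_; _⊓_)
open import Data.Bool using (Bool; true; false; _∧_; _∨_; if_then_else_)
open import Data.Fin using (Fin; zero; suc; _≟_)
open import Data.Product using (Σ; ∃; ∃-syntax; _×_; _,_)
open import Data.Sum using (_⊎_)
open import Relation.Nullary using (¬_; Dec; yes; no)
open import Relation.Nullary.Decidable using (⌊_⌋)
open import Relation.Binary.PropositionalEquality using (_≡_; _≢_)

record Graph (n : ℕ) : Set where
  field
    adj   : Fin n → Fin n → Bool
    adj-sym : ∀ u v → adj u v ≡ adj v u
    adj-irrefl : ∀ v → adj v v ≡ false
open Graph public

VSet : ℕ → Set
VSet n = Fin n → Bool

count : ∀ {n} → (Fin n → Bool) → ℕ
count {zero}  p = 0
count {suc n} p = (if p zero then 1 else 0) + count (λ i → p (suc i))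

∣_∣ₛ : ∀ {n} → VSet n → ℕ
∣ S ∣ₛ = count S

degree : ∀ {n} → Graph n → Fin n → ℕ
degree G v = count (λ u → adj G u v)

-- minimum of a function on Fin n (value 0 on the empty domain; only used for n ≥ 2)
minF : ∀ n → (Fin n → ℕ) → ℕ
minF zero f = 0
minF (suc zero) f = f zero
minF (suc (suc n)) f = f zero ⊓ minF (suc n) (λ i → f (suc i))

δ : ∀ {n} → Graph n → ℕ
δ {n} G = minF n (degree G)

nbrsIn : ∀ {n} → Graph n → VSet n → Fin n → ℕ
nbrsIn G S v = count (λ u → adj G u v ∧ S u)

KDominating : ∀ {n} → Graph n → ℕ → VSet n → Set
KDominating G k S = ∀ v → S v ≡ false → k ≤ nbrsIn G S v

_∪ₛ_ : ∀ {n} → VSet n → VSet n → VSet n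
(A ∪ₛ B) v = A v ∨ B v

Disjoint : ∀ {n} → VSet n → VSet n → Set
Disjoint A B = ∀ v → A v ∧ B v ≡ false

KCoalition : ∀ {n} → Graph n → ℕ → VSet n → VSet n → Set
KCoalition G k A B =
  Disjoint A B × ¬ KDominating G k A × ¬ KDominating G k B × KDominating G k (A ∪ₛ B)

-- A partition of V(G) = Fin n into exactly m (nonempty) parts, given by a
-- surjective labelling f : Fin n → Fin m; part i = f⁻¹(i).
part : ∀ {n m} → (Fin n → Fin m) → Fin m → VSet n
part f i v = ⌊ f v ≟ i ⌋

Surjective : ∀ {n m} → (Fin n → Fin m) → Set
Surjective {n} f = ∀ i → ∃[ v ] f v ≡ i

IsKCoalitionPartition : ∀ {n} → Graph n → ℕ → (m : ℕ) → (Fin n → Fin m) → Set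
IsKCoalitionPartition G k m f =
  Surjective f ×
  (∀ i → (KDominating G k (part f i) × ∣ part f i ∣ₛ ≡ k)
         ⊎ (∃[ j ] (j ≢ i × KCoalition G k (part f i) (part f j))))

HasKCoalitionPartition : ∀ {n} → Graph n → ℕ → ℕ → Set
HasKCoalitionPartition {n} G k m = ∃[ f ] IsKCoalitionPartition {n} G k m f

complete : ∀ n → Graph n
complete n = record
  { adj = λ u v → if ⌊ u ≟ v ⌋ then false else true
  ; adj-sym = symK
  ; adj-irrefl = irr }
  where
  open import Relation.Binary.PropositionalEquality using (refl; sym)
  open import Data.Empty using (⊥-elim)
  symK : ∀ u v → (if ⌊ u ≟ v ⌋ then false else true) ≡ (if ⌊ v ≟ u ⌋ then false else true)
  symK u v with u ≟ v | v ≟ u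
  ... | yes _ | yes _ = refl
  ... | no _ | no _ = refl
  ... | yes p | no q = ⊥-elim (q (sym p))
  ... | no p | yes q = ⊥-elim (p (sym q))
  irr : ∀ v → (if ⌊ v ≟ v ⌋ then false else true) ≡ false
  irr v with v ≟ v
  ... | yes _ = refl
  ... | no ¬p = ⊥-elim (¬p refl)

{-# OPTIONS --safe #-}
module Submission where

-- Let v be a vertex of minimum degree δ, write k = k′ + 1 and
-- t = δ ∸ k′, and let C consist of v and t of its neighbours. Partition V into
-- the singletons of C and the rest R = V ∖ C. Since k ≥ 2 no singleton is
-- k-dominating, and R is not either: v has only δ − t ≤ k′ neighbours in R.
-- For x ∈ C the set R ∪ {x} misses t vertices, each of which has at least
-- δ − (t − 1) ≥ k neighbours in it, so R forms a k-coalition with every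
-- singleton and the partition has t + 2 ≥ δ − k + 3 parts.
--
-- In a k-coalition partition of K_n with m ≥ 3 parts,
-- the first part either has k vertices or forms a coalition with a second part;
-- the union then k-dominates a vertex of a third part, so in K_n it has at least
-- k vertices. All other parts are nonempty, hence k + (m − 2) ≤ n.

open import Defs
open import Data.Bool using (Bool; true; false; _∧_; _∨_; not; if_then_else_)
open import Data.Bool.Properties using (∧-comm; ∧-conicalʳ; ∧-zeroʳ; ∨-comm; ∨-conicalˡ; ∨-zeroʳ; not-injective)
open import Data.Empty using (⊥-elim)
open import Data.Fin using (Fin; zero; suc; _≟_; fromℕ<; toℕ; punchIn; punchOut)
open import Data.Fin.Properties using (suc-injective; 0≢1+n; toℕ-fromℕ<; toℕ-injective; toℕ<n; punchInᵢ≢i; punchIn-punchOut)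
open import Data.Nat using (ℕ; zero; suc; _+_; _∸_; _⊓_; _≤_; _<_; _<ᵇ_; z≤n; s≤s; s≤s⁻¹)
open import Data.Nat.Properties
  using ( ≤-refl; ≤-reflexive; ≤-trans; ≤-antisym; ≤-<-trans; <⇒≤; <⇒≱; n≤1+n; m≤n⇒m≤1+n; m<n⇒m<1+n
        ; m≤m+n; m≤n+m; +-comm; +-assoc; +-suc; +-mono-≤; +-monoˡ-≤; +-monoʳ-≤; +-monoʳ-<
        ; +-cancelˡ-≤; +-cancelʳ-≤; m⊓n≤m; m⊓n≤n; ⊓-sel; ⊓-zeroʳ; m≤n⇒m⊓n≡m
        ; m∸n≤m; m≤n+m∸n; m∸n+n≡m; m∸n≢0⇒n<m; m<n⇒n≢0; +-0-commutativeMonoid; module ≤-Reasoning )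
import Data.Nat.Properties as ℕ
open import Algebra.Properties.CommutativeMonoid.Sum +-0-commutativeMonoid
  using (sum; sum-remove; sum-cong-≗; sum-replicate-zero; ∑-distrib-+)
open import Data.Product using (_×_; _,_; ∃-syntax; proj₁; proj₂)
open import Data.Sum using (_⊎_; inj₁; inj₂)
open import Data.Vec.Functional using (removeAt)
open import Function using (_∘_)
open import Relation.Binary.PropositionalEquality
open import Relation.Nullary using (¬_; yes; no)
open import Relation.Nullary.Decidable using (⌊_⌋)

-- Counting and ranks

_⊆_ : ∀ {n} → (Fin n → Bool) → (Fin n → Bool) → Set
p ⊆ q = ∀ i → p i ≡ true → q i ≡ true

AtMostOne : ∀ {n} → (Fin n → Bool) → Set
AtMostOne p = ∀ a b → p a ≡ true → p b ≡ true → a ≡ b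

count-cong : ∀ {n} {p q : Fin n → Bool} → (∀ i → p i ≡ q i) → count p ≡ count q
count-cong {zero}  p≗q = refl
count-cong {suc n} p≗q rewrite p≗q zero = cong (_ +_) (count-cong (λ i → p≗q (suc i)))

count-mono : ∀ {n} {p q : Fin n → Bool} → p ⊆ q → count p ≤ count q
count-mono {zero}          p⊆q = z≤n
count-mono {suc n} {p} {q} p⊆q with p zero in p0 | q zero in q0
... | true  | true  = s≤s (count-mono (λ i → p⊆q (suc i)))
... | false | true  = m≤n⇒m≤1+n (count-mono (λ i → p⊆q (suc i)))
... | false | false = count-mono (λ i → p⊆q (suc i))
... | true  | false with () ← trans (sym (p⊆q zero p0)) q0

count-mono-< : ∀ {n} {p q : Fin n → Bool} → p ⊆ q → ∀ x → q x ≡ true → p x ≡ false → count p < count q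
count-mono-< {suc n} {p} {q} p⊆q zero qx px rewrite qx | px = s≤s (count-mono (λ i → p⊆q (suc i)))
count-mono-< {suc n} {p} {q} p⊆q (suc x) qx px with p zero in p0 | q zero in q0
... | true  | true  = s≤s (count-mono-< (λ i → p⊆q (suc i)) x qx px)
... | false | true  = m<n⇒m<1+n (count-mono-< (λ i → p⊆q (suc i)) x qx px)
... | false | false = count-mono-< (λ i → p⊆q (suc i)) x qx px
... | true  | false with () ← trans (sym (p⊆q zero p0)) q0

count-pos : ∀ {n} {p : Fin n → Bool} x → p x ≡ true → 0 < count p
count-pos {suc n}     zero    px rewrite px = s≤s z≤n
count-pos {suc n} {p} (suc x) px = ≤-trans (count-pos x px) (m≤n+m _ (if p zero then 1 else 0))

count-none : ∀ {n} {p : Fin n → Bool} → (∀ i → p i ≡ false) → count p ≡ 0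
count-none {zero}  none = refl
count-none {suc n} none rewrite none zero = count-none (λ i → none (suc i))

count-all : ∀ n → count {n} (λ _ → true) ≡ n
count-all zero    = refl
count-all (suc n) = cong suc (count-all n)

count<n⇒false : ∀ {n} (p : Fin n → Bool) → count p < n → ∃[ u ] p u ≡ false
count<n⇒false {suc n} p c<n with p zero in p0
... | false = zero , p0
... | true with count<n⇒false (λ i → p (suc i)) (s≤s⁻¹ c<n)
...   | u , pu = suc u , pu

count-∨ : ∀ {n} (p q : Fin n → Bool) → count (λ i → p i ∨ q i) ≤ count p + count q
count-∨ {zero}  p q = z≤n
count-∨ {suc n} p q with p zero | q zero | count-∨ (λ i → p (suc i)) (λ i → q (suc i))
... | true  | true  | ih = s≤s (≤-trans ih (+-monoʳ-≤ _ (n≤1+n _)))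
... | true  | false | ih = s≤s ih
... | false | true  | ih = ≤-trans (s≤s ih) (≤-reflexive (sym (+-suc _ _)))
... | false | false | ih = ih

count-split : ∀ {n} (p q : Fin n → Bool) → count (λ i → p i ∧ q i) + count (λ i → p i ∧ not (q i)) ≡ count p
count-split {zero}  p q = refl
count-split {suc n} p q with p zero | q zero | count-split (λ i → p (suc i)) (λ i → q (suc i))
... | true  | true  | ih = cong suc ih
... | true  | false | ih = trans (+-suc _ _) (cong suc ih)
... | false | _     | ih = ih

count≤1 : ∀ {n} (p : Fin n → Bool) → AtMostOne p → count p ≤ 1
count≤1 {zero}  p uniq = z≤n
count≤1 {suc n} p uniq with p zero in p0
... | true  = ≤-reflexive (cong suc (count-none rest))
  where
  rest : ∀ i → p (suc i) ≡ false
  rest i with p (suc i) in pi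
  ... | false = refl
  ... | true with () ← uniq zero (suc i) p0 pi
... | false = count≤1 (λ i → p (suc i)) (λ a b pa pb → suc-injective (uniq (suc a) (suc b) pa pb))

rank : ∀ {n} → (Fin n → Bool) → Fin n → ℕ
rank p zero    = 0
rank p (suc u) = (if p zero then 1 else 0) + rank (λ i → p (suc i)) u

rank<count : ∀ {n} (p : Fin n → Bool) u → p u ≡ true → rank p u < count p
rank<count {suc n} p zero    pu rewrite pu = s≤s z≤n
rank<count {suc n} p (suc u) pu with p zero
... | true  = s≤s (rank<count (λ i → p (suc i)) u pu)
... | false = rank<count (λ i → p (suc i)) u pu

rank-injective : ∀ {n} (p : Fin n → Bool) a b → p a ≡ true → p b ≡ true → rank p a ≡ rank p b → a ≡ b
rank-injective p zero    zero    pa pb ra≡rb = refl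
rank-injective p zero    (suc b) pa pb ra≡rb rewrite pa with () ← ra≡rb
rank-injective p (suc a) zero    pa pb ra≡rb rewrite pb with () ← ra≡rb
rank-injective {suc n} p (suc a) (suc b) pa pb ra≡rb with p zero
... | true  = cong suc (rank-injective (λ i → p (suc i)) a b pa pb (ℕ.suc-injective ra≡rb))
... | false = cong suc (rank-injective (λ i → p (suc i)) a b pa pb ra≡rb)

rank-surjective : ∀ {n} (p : Fin n → Bool) r → r < count p → ∃[ u ] (p u ≡ true × rank p u ≡ r)
rank-surjective {suc n} p r r<c with p zero in p0
rank-surjective {suc n} p zero    r<c       | true = zero , p0 , refl
rank-surjective {suc n} p (suc r) (s≤s r<c) | true with rank-surjective (λ i → p (suc i)) r r<c
... | u , pu , ru = suc u , pu , rank≡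
  where
  rank≡ : rank p (suc u) ≡ suc r
  rank≡ rewrite p0 = cong suc ru
rank-surjective {suc n} p r r<c | false with rank-surjective (λ i → p (suc i)) r r<c
... | u , pu , ru = suc u , pu , rank≡
  where
  rank≡ : rank p (suc u) ≡ r
  rank≡ rewrite p0 = ru

initial : ∀ {n} → (Fin n → Bool) → ℕ → Fin n → Bool
initial p t u = p u ∧ (rank p u <ᵇ t)

count-initial : ∀ {n} (p : Fin n → Bool) t → count (initial p t) ≡ t ⊓ count p
count-initial {zero}  p t = sym (⊓-zeroʳ t)
count-initial {suc n} p t with p zero
count-initial {suc n} p zero    | true  = count-none (λ i → ∧-zeroʳ (p (suc i)))
count-initial {suc n} p (suc t) | true  = cong suc (count-initial (λ i → p (suc i)) t)
count-initial {suc n} p t       | false = count-initial (λ i → p (suc i)) t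

≟-refl : ∀ {n} (u : Fin n) → ⌊ u ≟ u ⌋ ≡ true
≟-refl u with u ≟ u
... | yes _   = refl
... | no u≢u = ⊥-elim (u≢u refl)

≟-≢ : ∀ {n} {u v : Fin n} → u ≢ v → ⌊ u ≟ v ⌋ ≡ false
≟-≢ {u = u} {v} u≢v with u ≟ v
... | yes u≡v = ⊥-elim (u≢v u≡v)
... | no _    = refl

≟-true⇒≡ : ∀ {n} {u v : Fin n} → ⌊ u ≟ v ⌋ ≡ true → u ≡ v
≟-true⇒≡ {u = u} {v} eq with u ≟ v
... | yes u≡v = u≡v

singleton-count : ∀ {n} (v : Fin n) → count (λ u → ⌊ u ≟ v ⌋) ≡ 1
singleton-count v = ≤-antisym (count≤1 (λ u → ⌊ u ≟ v ⌋) unique) (count-pos v (≟-refl v))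
  where
  unique : AtMostOne (λ u → ⌊ u ≟ v ⌋)
  unique a b a≡v b≡v = trans (≟-true⇒≡ a≡v) (sym (≟-true⇒≡ b≡v))

≡⇒part : ∀ {n m} (f : Fin n → Fin m) {i} u → f u ≡ i → part f i u ≡ true
≡⇒part f u refl = ≟-refl (f u)

part⇒≡ : ∀ {n m} (f : Fin n → Fin m) {i} u → part f i u ≡ true → f u ≡ i
part⇒≡ f u = ≟-true⇒≡

parts-disjoint : ∀ {n m} (f : Fin n → Fin m) {i j} → i ≢ j → Disjoint (part f i) (part f j)
parts-disjoint f {i} {j} i≢j u with f u ≟ i | f u ≟ j
... | yes fu≡i | yes fu≡j = ⊥-elim (i≢j (trans (sym fu≡i) fu≡j))
... | yes _    | no _     = refl
... | no _     | _        = refl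

-- Degrees and domination

∁ : ∀ {n} → VSet n → VSet n
∁ A u = not (A u)

minF-≤ : ∀ n (f : Fin n → ℕ) i → minF n f ≤ f i
minF-≤ (suc zero)    f zero    = ≤-refl
minF-≤ (suc (suc n)) f zero    = m⊓n≤m _ _
minF-≤ (suc (suc n)) f (suc i) = ≤-trans (m⊓n≤n (f zero) _) (minF-≤ (suc n) (λ j → f (suc j)) i)

minF-attained : ∀ n (f : Fin (suc n) → ℕ) → ∃[ v ] f v ≡ minF (suc n) f
minF-attained zero    f = zero , refl
minF-attained (suc n) f with ⊓-sel (f zero) (minF (suc n) (λ i → f (suc i)))
... | inj₁ min≡f0 = zero , sym min≡f0
... | inj₂ min≡rest with minF-attained n (λ i → f (suc i))
...   | v , fv≡rest = suc v , trans fv≡rest (sym min≡rest)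

δ≤degree : ∀ {n} (G : Graph n) u → δ G ≤ degree G u
δ≤degree {n} G = minF-≤ n (degree G)

δ-attained : ∀ {n} (G : Graph (suc n)) → ∃[ v ] degree G v ≡ δ G
δ-attained {n} G = minF-attained n (degree G)

degree<n : ∀ {n} (G : Graph n) v → degree G v < n
degree<n {n} G v = subst (degree G v <_) (count-all n)
  (count-mono-< (λ _ _ → refl) v refl (adj-irrefl G v))

nbrsIn≤count : ∀ {n} (G : Graph n) A w → nbrsIn G A w ≤ count A
nbrsIn≤count G A w = count-mono (λ u → ∧-conicalʳ (adj G u w) (A u))

degree<nbrsIn+∁ : ∀ {n} (G : Graph n) A w → A w ≡ false → degree G w < nbrsIn G A w + count (∁ A)
degree<nbrsIn+∁ G A w Aw = begin-strict
  degree G w                                                       ≡⟨ count-split (λ u → adj G u w) A ⟨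
  nbrsIn G A w + count (λ u → adj G u w ∧ not (A u))               <⟨ +-monoʳ-< (nbrsIn G A w) outside-w ⟩
  nbrsIn G A w + count (∁ A)                                        ∎
  where
  open ≤-Reasoning
  outside-w : count (λ u → adj G u w ∧ not (A u)) < count (∁ A)
  outside-w = count-mono-< (λ u → ∧-conicalʳ (adj G u w) _) w (cong not Aw)
                           (cong (_∧ not (A w)) (adj-irrefl G w))

few-outside⇒KDominating : ∀ {n} (G : Graph n) k A →
  (∀ w → A w ≡ false → count (∁ A) + k ≤ suc (degree G w)) → KDominating G k A
few-outside⇒KDominating G k A bound w Aw = +-cancelˡ-≤ (count (∁ A)) k (nbrsIn G A w) (begin
  count (∁ A) + k              ≤⟨ bound w Aw ⟩
  suc (degree G w)             ≤⟨ degree<nbrsIn+∁ G A w Aw ⟩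
  nbrsIn G A w + count (∁ A)   ≡⟨ +-comm (nbrsIn G A w) _ ⟩
  count (∁ A) + nbrsIn G A w   ∎)
  where open ≤-Reasoning

few-neighbours⇒¬KDominating : ∀ {n} (G : Graph n) k A w → A w ≡ false → nbrsIn G A w < k → ¬ KDominating G k A
few-neighbours⇒¬KDominating G k A w Aw few dom = <⇒≱ few (dom w Aw)

KDominating-cong : ∀ {n} (G : Graph n) k {A B} → (∀ u → A u ≡ B u) → KDominating G k A → KDominating G k B
KDominating-cong G k A≗B dom w Bw =
  subst (k ≤_) (count-cong (λ u → cong (adj G u w ∧_) (A≗B u))) (dom w (trans (A≗B w) Bw))

KCoalition-sym : ∀ {n} (G : Graph n) k {A B} → KCoalition G k A B → KCoalition G k B A
KCoalition-sym G k {A} {B} (disj , ¬domA , ¬domB , domA∪B) =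
  (λ u → trans (∧-comm (B u) (A u)) (disj u)) , ¬domB , ¬domA ,
  KDominating-cong G k (λ u → ∨-comm (A u) (B u)) domA∪B

-- The lower bound

-- Label zero marks the part V ∖ C, label suc j the vertex of C of rank j.
module SingletonsAndRest {n} (C : VSet n) where

  label-by : ∀ u b → C u ≡ b → Fin (suc (count C))
  label-by u true  Cu = suc (fromℕ< (rank<count C u Cu))
  label-by u false _  = zero

  label : Fin n → Fin (suc (count C))
  label u = label-by u (C u) refl

  label-member : ∀ u → C u ≡ true → ∃[ j ] (label u ≡ suc j × toℕ j ≡ rank C u)
  label-member u = by-cases (C u) refl
    where
    by-cases : ∀ b (Cu : C u ≡ b) → b ≡ true → ∃[ j ] (label-by u b Cu ≡ suc j × toℕ j ≡ rank C u)
    by-cases true Cu _ = fromℕ< (rank<count C u Cu) , refl , toℕ-fromℕ< _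

  part-zero : ∀ u → part label zero u ≡ not (C u)
  part-zero u = by-cases (C u) refl
    where
    by-cases : ∀ b (Cu : C u ≡ b) → ⌊ label-by u b Cu ≟ zero ⌋ ≡ not b
    by-cases true  _ = refl
    by-cases false _ = refl

  part-suc⊆C : ∀ j → part label (suc j) ⊆ C
  part-suc⊆C j u in-j = not-injective (begin
    not (C u)              ≡⟨ part-zero u ⟨
    part label zero u      ≡⟨ ≟-≢ (λ lu≡0 → 0≢1+n (trans (sym lu≡0) (part⇒≡ label u in-j))) ⟩
    false                  ∎)
    where open ≡-Reasoning

  part-suc-unique : ∀ j → AtMostOne (part label (suc j))
  part-suc-unique j a b a∈j b∈j = rank-injective C a b (part-suc⊆C j a a∈j) (part-suc⊆C j b b∈j)
    (trans (rank≡toℕ a a∈j) (sym (rank≡toℕ b b∈j)))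
    where
    rank≡toℕ : ∀ u → part label (suc j) u ≡ true → rank C u ≡ toℕ j
    rank≡toℕ u u∈j with label-member u (part-suc⊆C j u u∈j)
    ... | i , lu≡i , i≡rank = trans (sym i≡rank) (cong toℕ (suc-injective (trans (sym lu≡i) (part⇒≡ label u u∈j))))

  label-∉C : ∀ u → C u ≡ false → label u ≡ zero
  label-∉C u Cu = ≟-true⇒≡ (trans (part-zero u) (cong not Cu))

  label-surjective : ∀ w → C w ≡ false → Surjective label
  label-surjective w Cw zero    = w , label-∉C w Cw
  label-surjective w Cw (suc j) with rank-surjective C (toℕ j) (toℕ<n j)
  ... | u , Cu , rank≡j with label-member u Cu
  ...   | i , lu≡i , i≡rank = u , trans lu≡i (cong suc (toℕ-injective (trans i≡rank rank≡j)))

  -- If |C| ≤ 1 every union R ∪ {x} is all of V, so no degree condition is needed.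
  singletons-and-rest : ∀ (G : Graph n) k v w → 2 ≤ k → C v ≡ true → C w ≡ false →
    nbrsIn G (∁ C) v < k → (2 ≤ count C → count C + k ≤ 2 + δ G) →
    IsKCoalitionPartition G k (suc (count C)) label
  singletons-and-rest G k v w 2≤k Cv Cw few-nbrs δ-large = label-surjective w Cw , λ where
      zero    → inj₂ (suc first , (λ ()) , rest-coalition first)
      (suc j) → inj₂ (zero , (λ ()) , KCoalition-sym G k (rest-coalition j))
    where
    first : Fin (count C)
    first = fromℕ< (count-pos v Cv)

    rest-¬dom : ¬ KDominating G k (part label zero)
    rest-¬dom = few-neighbours⇒¬KDominating G k _ v (trans (part-zero v) (cong not Cv))
      (subst (_< k) (count-cong (λ u → cong (adj G u v ∧_) (sym (part-zero u)))) few-nbrs)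

    singleton-¬dom : ∀ j → ¬ KDominating G k (part label (suc j))
    singleton-¬dom j = few-neighbours⇒¬KDominating G k _ w
      (≟-≢ (λ lw≡j → 0≢1+n (trans (sym (label-∉C w Cw)) lw≡j)))
      (≤-<-trans (nbrsIn≤count G _ w) (≤-<-trans (count≤1 _ (part-suc-unique j)) 2≤k))

    union-dom : ∀ j → KDominating G k (part label zero ∪ₛ part label (suc j))
    union-dom j = few-outside⇒KDominating G k A bound
      where
      A : VSet n
      A = part label zero ∪ₛ part label (suc j)
      x : Fin n
      x = proj₁ (label-surjective w Cw (suc j))
      x∈j : part label (suc j) x ≡ true
      x∈j = ≡⇒part label x (proj₂ (label-surjective w Cw (suc j)))
      x∈A : A x ≡ true
      x∈A = trans (cong (part label zero x ∨_) x∈j) (∨-zeroʳ (part label zero x))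
      ∁A⊆C : ∁ A ⊆ C
      ∁A⊆C u u∉A = not-injective (trans (sym (part-zero u)) (∨-conicalˡ _ _ (not-injective u∉A)))
      ∁A⊂C : count (∁ A) < count C
      ∁A⊂C = count-mono-< ∁A⊆C x (part-suc⊆C j x x∈j) (cong not x∈A)
      bound : ∀ y → A y ≡ false → count (∁ A) + k ≤ suc (degree G y)
      bound y Ay = s≤s⁻¹ (begin
        suc (count (∁ A)) + k   ≤⟨ +-monoˡ-≤ k ∁A⊂C ⟩
        count C + k             ≤⟨ δ-large (≤-trans (s≤s (count-pos y (cong not Ay))) ∁A⊂C) ⟩
        2 + δ G                 ≤⟨ +-monoʳ-≤ 2 (δ≤degree G y) ⟩
        2 + degree G y          ∎)
        where open ≤-Reasoning

    rest-coalition : ∀ j → KCoalition G k (part label zero) (part label (suc j))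
    rest-coalition j = parts-disjoint label (λ ()) , rest-¬dom , singleton-¬dom j , union-dom j

∧-not-∨-∧ : ∀ a e b → a ∧ not (e ∨ (a ∧ b)) ≡ true → a ∧ not b ≡ true
∧-not-∨-∧ true  false false _ = refl
∧-not-∨-∧ true  false true  ()
∧-not-∨-∧ true  true  _     ()
∧-not-∨-∧ false _     _     ()

suc[m∸n]<o : ∀ m {n o} → 0 < n → m < o → 2 ≤ o → suc (m ∸ n) < o
suc[m∸n]<o zero    {suc n} _ _   2≤o = 2≤o
suc[m∸n]<o (suc m) {suc n} _ m<o _   = ≤-<-trans (s≤s (m∸n≤m m n)) m<o

module MinimumDegreeCore {n} (G : Graph (suc n)) (k′ : ℕ) where

  v : Fin (suc n)
  v = proj₁ (δ-attained G)

  degree-v : degree G v ≡ δ G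
  degree-v = proj₂ (δ-attained G)

  N : VSet (suc n)
  N u = adj G u v

  -- When δ G < k′ this is 0, so that C = {v} and the partition is {v}, V ∖ {v}.
  t : ℕ
  t = δ G ∸ k′

  C : VSet (suc n)
  C u = ⌊ u ≟ v ⌋ ∨ initial N t u

  v∈C : C v ≡ true
  v∈C = cong (_∨ initial N t v) (≟-refl v)

  count-initial-N : count (initial N t) ≡ t
  count-initial-N = trans (count-initial N t) (trans (cong (t ⊓_) degree-v) (m≤n⇒m⊓n≡m (m∸n≤m (δ G) k′)))

  count-C : count C ≡ suc t
  count-C = ≤-antisym
    (≤-trans (count-∨ (λ u → ⌊ u ≟ v ⌋) (initial N t)) (≤-reflexive (cong₂ _+_ (singleton-count v) count-initial-N)))
    (subst (_< count C) count-initial-N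
      (count-mono-< {p = initial N t} (λ u Su → trans (cong (⌊ u ≟ v ⌋ ∨_) Su) (∨-zeroʳ _)) v v∈C
                    (cong (_∧ (rank N v <ᵇ t)) (adj-irrefl G v))))

  nbrsIn-∁C : nbrsIn G (∁ C) v ≤ k′
  nbrsIn-∁C = ≤-trans (count-mono {q = late} (λ u → ∧-not-∨-∧ (N u) ⌊ u ≟ v ⌋ (rank N u <ᵇ t)))
                      (+-cancelˡ-≤ t _ k′ (begin
    t + count late                    ≡⟨ cong (_+ count late) count-initial-N ⟨
    count (initial N t) + count late  ≡⟨ count-split N (λ u → rank N u <ᵇ t) ⟩
    degree G v                        ≡⟨ degree-v ⟩
    δ G                               ≤⟨ m≤n+m∸n (δ G) k′ ⟩
    k′ + t                            ≡⟨ +-comm k′ t ⟩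
    t + k′                            ∎))
    where
    open ≤-Reasoning
    late : VSet (suc n)
    late u = N u ∧ not (rank N u <ᵇ t)

  outside-C : 0 < k′ → 2 ≤ suc n → ∃[ w ] C w ≡ false
  outside-C 0<k′ 2≤n = count<n⇒false C (subst (_< suc n) (sym count-C)
    (suc[m∸n]<o (δ G) 0<k′ (subst (_< suc n) degree-v (degree<n G v)) 2≤n))

  δ-large : 2 ≤ count C → count C + suc k′ ≤ 2 + δ G
  δ-large 2≤C = ≤-reflexive (begin-equality
    count C + suc k′    ≡⟨ cong (_+ suc k′) count-C ⟩
    suc t + suc k′      ≡⟨ cong suc (+-suc t k′) ⟩
    2 + (t + k′)        ≡⟨ cong (2 +_) (m∸n+n≡m (<⇒≤ k′<δ)) ⟩
    2 + δ G             ∎)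
    where
    open ≤-Reasoning
    k′<δ : k′ < δ G
    k′<δ = m∸n≢0⇒n<m (m<n⇒n≢0 (s≤s⁻¹ (subst (2 ≤_) count-C 2≤C)))

  δ+3≤parts+k : δ G + 3 ≤ suc (count C) + suc k′
  δ+3≤parts+k = begin
    δ G + 3                 ≡⟨ +-comm (δ G) 3 ⟩
    3 + δ G                 ≤⟨ +-monoʳ-≤ 3 (m≤n+m∸n (δ G) k′) ⟩
    3 + (k′ + t)            ≡⟨ cong (2 +_) (trans (cong suc (+-comm k′ t)) (sym (+-suc t k′))) ⟩
    suc (suc t) + suc k′    ≡⟨ cong (λ c → suc c + suc k′) count-C ⟨
    suc (count C) + suc k′  ∎
    where open ≤-Reasoning

coalition-lower-bound : (n k : ℕ) → 2 ≤ n → 2 ≤ k → (G : Graph n) →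
  ∃[ m ] (HasKCoalitionPartition G k m × δ G + 3 ≤ m + k)
coalition-lower-bound (suc n) (suc k′) 2≤n 2≤k@(s≤s 0<k′) G =
  suc (count C) , (label , partition) , δ+3≤parts+k
  where
  open MinimumDegreeCore G k′
  open SingletonsAndRest C
  partition : IsKCoalitionPartition G (suc k′) (suc (count C)) label
  partition with w , w∉C ← outside-C 0<k′ 2≤n =
    singletons-and-rest G (suc k′) v w 2≤k v∈C w∉C (s≤s nbrsIn-∁C) δ-large

-- Complete graphs

adj-complete : ∀ {n} (u v : Fin n) → adj (complete n) u v ≡ not ⌊ u ≟ v ⌋
adj-complete u v with u ≟ v
... | yes _ = refl
... | no _  = refl

nbrsIn-complete : ∀ {n} (A : VSet n) w → A w ≡ false → nbrsIn (complete n) A w ≡ count A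
nbrsIn-complete A w Aw = count-cong adj∧A≗A
  where
  adj∧A≗A : ∀ u → adj (complete _) u w ∧ A u ≡ A u
  adj∧A≗A u with u ≟ w
  ... | yes refl = sym Aw
  ... | no _     = refl

degree-complete : ∀ n v → degree (complete (suc n)) v ≡ n
degree-complete n v = ℕ.suc-injective (begin
  1 + degree (complete (suc n)) v                              ≡⟨ cong₂ _+_ (sym (singleton-count v)) (count-cong (λ u → adj-complete u v)) ⟩
  count (λ u → ⌊ u ≟ v ⌋) + count (λ u → not ⌊ u ≟ v ⌋)         ≡⟨ count-split (λ _ → true) (λ u → ⌊ u ≟ v ⌋) ⟩
  count {suc n} (λ _ → true)                                   ≡⟨ count-all (suc n) ⟩
  suc n                                                        ∎)
  where open ≡-Reasoning

δ-complete : ∀ n → δ (complete (suc n)) ≡ n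
δ-complete n with δ-attained (complete (suc n))
... | v , deg≡δ = trans (sym deg≡δ) (degree-complete n v)

KDominating-complete⇒k≤count : ∀ {n} k (A : VSet n) w → A w ≡ false → KDominating (complete n) k A → k ≤ count A
KDominating-complete⇒k≤count k A w Aw dom = subst (k ≤_) (nbrsIn-complete A w Aw) (dom w Aw)

indicator : ∀ {m} → Fin m → Fin m → ℕ
indicator j i = if ⌊ j ≟ i ⌋ then 1 else 0

sum-indicator : ∀ {m} (j : Fin m) → sum (indicator j) ≡ 1
sum-indicator {suc m} j = begin
  sum (indicator j)                                 ≡⟨ sum-remove (indicator j) ⟩
  indicator j j + sum (removeAt (indicator j) j)    ≡⟨ cong₂ (λ b s → (if b then 1 else 0) + s) (≟-refl j)
                                                             (sum-cong-≗ (λ i → cong (λ b → if b then 1 else 0) (≟-≢ (punchInᵢ≢i j i ∘ sym)))) ⟩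
  1 + sum {m} (λ _ → 0)                             ≡⟨ cong suc (sum-replicate-zero m) ⟩
  1                                                 ∎
  where open ≡-Reasoning

sum-part-sizes : ∀ {n m} (f : Fin n → Fin m) → sum (λ i → count (part f i)) ≡ n
sum-part-sizes {zero}  {m} f = sum-replicate-zero m
sum-part-sizes {suc n} {m} f = begin
  sum (λ i → count (part f i))                                              ≡⟨ ∑-distrib-+ (indicator (f zero)) (λ i → count (part f′ i)) ⟩
  sum (indicator (f zero)) + sum (λ i → count (part f′ i))                  ≡⟨ cong₂ _+_ (sum-indicator (f zero)) (sum-part-sizes f′) ⟩
  suc n                                                                     ∎
  where
  open ≡-Reasoning
  f′ : Fin n → Fin m
  f′ u = f (suc u)

length≤sum : ∀ {m} (a : Fin m → ℕ) → (∀ i → 0 < a i) → m ≤ sum a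
length≤sum {zero}  a pos = z≤n
length≤sum {suc m} a pos = +-mono-≤ (pos zero) (length≤sum (λ i → a (suc i)) (λ i → pos (suc i)))

one+length≤sum : ∀ {m} (a : Fin (suc m) → ℕ) → (∀ i → 0 < a i) → ∀ i → a i + m ≤ sum a
one+length≤sum a pos i = begin
  a i + _                  ≤⟨ +-monoʳ-≤ (a i) (length≤sum (removeAt a i) (λ l → pos (punchIn i l))) ⟩
  a i + sum (removeAt a i) ≡⟨ sum-remove a ⟨
  sum a                    ∎
  where open ≤-Reasoning

two+length≤sum : ∀ {m} (a : Fin (suc (suc m)) → ℕ) → (∀ i → 0 < a i) → ∀ {i j} → i ≢ j → a i + a j + m ≤ sum a
two+length≤sum {m} a pos {i} {j} i≢j = begin
  a i + a j + m                                  ≡⟨ +-assoc (a i) (a j) m ⟩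
  a i + (a j + m)                                ≡⟨ cong (λ l → a i + (a l + m)) (punchIn-punchOut i≢j) ⟨
  a i + (removeAt a i (punchOut i≢j) + m)        ≤⟨ +-monoʳ-≤ (a i) (one+length≤sum (removeAt a i) (λ l → pos (punchIn i l)) _) ⟩
  a i + sum (removeAt a i)                       ≡⟨ sum-remove a ⟨
  sum a                                          ∎
  where open ≤-Reasoning

m≤2⇒m+k≤n+2 : ∀ {n k m} → m ≤ 2 → k ≤ n → m + k ≤ n + 2
m≤2⇒m+k≤n+2 {n} {k} {m} m≤2 k≤n = subst (m + k ≤_) (+-comm 2 n) (+-mono-≤ m≤2 k≤n)

third-label : ∀ {m} (j : Fin (3 + m)) → ∃[ l ] (l ≢ zero × l ≢ j)
third-label zero          = suc zero , (λ ()) , (λ ())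
third-label (suc zero)    = suc (suc zero) , (λ ()) , (λ ())
third-label (suc (suc j)) = suc zero , (λ ()) , (λ ())

coalition-upper-bound-complete : ∀ {n k m} (f : Fin n → Fin m) → k ≤ n →
  IsKCoalitionPartition (complete n) k m f → m + k ≤ n + 2
coalition-upper-bound-complete {m = zero}           f k≤n _ = m≤2⇒m+k≤n+2 z≤n k≤n
coalition-upper-bound-complete {m = suc zero}       f k≤n _ = m≤2⇒m+k≤n+2 (s≤s z≤n) k≤n
coalition-upper-bound-complete {m = suc (suc zero)} f k≤n _ = m≤2⇒m+k≤n+2 ≤-refl k≤n
coalition-upper-bound-complete {n} {k} {suc (suc (suc m))} f k≤n (surj , cond) =
  bound (partner-of-zero (cond zero))
  where
  size : Fin (3 + m) → ℕ
  size i = count (part f i)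
  size-pos : ∀ i → 0 < size i
  size-pos i with surj i
  ... | x , refl = count-pos x (≡⇒part f x refl)
  partner-of-zero : (KDominating (complete n) k (part f zero) × size zero ≡ k)
                    ⊎ (∃[ j ] (j ≢ zero × KCoalition (complete n) k (part f zero) (part f j)))
                  → ∃[ j ] (j ≢ zero × k ≤ size zero + size j)
  partner-of-zero (inj₁ (_ , size≡k)) = suc zero , (λ ()) , subst (_≤ size zero + size (suc zero)) size≡k (m≤m+n _ _)
  partner-of-zero (inj₂ (j , j≢0 , _ , _ , _ , dom)) with third-label j
  ... | l , l≢0 , l≢j with surj l
  ...   | x , refl = j , j≢0 , ≤-trans (KDominating-complete⇒k≤count k _ x x∉ dom) (count-∨ (part f zero) (part f j))
    where
    x∉ : (part f zero ∪ₛ part f j) x ≡ false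
    x∉ rewrite ≟-≢ l≢0 | ≟-≢ l≢j = refl
  bound : ∃[ j ] (j ≢ zero × k ≤ size zero + size j) → 3 + m + k ≤ n + 2
  bound (j , j≢0 , k≤0+j) = begin
    3 + m + k                        ≡⟨ cong (2 +_) (+-comm (suc m) k) ⟩
    2 + (k + suc m)                  ≤⟨ +-monoʳ-≤ 2 (+-monoˡ-≤ (suc m) k≤0+j) ⟩
    2 + (size zero + size j + suc m) ≤⟨ +-monoʳ-≤ 2 (two+length≤sum size size-pos (j≢0 ∘ sym)) ⟩
    2 + sum size                     ≡⟨ cong (2 +_) (sum-part-sizes f) ⟩
    2 + n                            ≡⟨ +-comm 2 n ⟩
    n + 2                            ∎
    where open ≤-Reasoning

complete-coalition-number : (n k : ℕ) → 2 ≤ k → k + 1 ≤ n →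
  ∃[ m ] (HasKCoalitionPartition (complete n) k m
          × (∀ m′ → HasKCoalitionPartition (complete n) k m′ → m′ ≤ m)
          × m + k ≡ δ (complete n) + 3
          × m + k ≡ n + 2)
complete-coalition-number zero    (suc (suc k)) _   ()
complete-coalition-number (suc n) k             2≤k k+1≤n =
  m , has-m , maximal , trans m+k≡n+2 (sym δ+3≡n+2) , m+k≡n+2
  where
  k≤n : k ≤ n
  k≤n = s≤s⁻¹ (subst (_≤ suc n) (+-comm k 1) k+1≤n)
  lower : ∃[ m ] (HasKCoalitionPartition (complete (suc n)) k m × δ (complete (suc n)) + 3 ≤ m + k)
  lower = coalition-lower-bound (suc n) k (≤-trans 2≤k (m≤n⇒m≤1+n k≤n)) 2≤k (complete (suc n))
  m : ℕ
  m = proj₁ lower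
  has-m : HasKCoalitionPartition (complete (suc n)) k m
  has-m = proj₁ (proj₂ lower)
  δ+3≡n+2 : δ (complete (suc n)) + 3 ≡ suc n + 2
  δ+3≡n+2 = trans (cong (_+ 3) (δ-complete n)) (+-suc n 2)
  upper : ∀ m′ → HasKCoalitionPartition (complete (suc n)) k m′ → m′ + k ≤ suc n + 2
  upper m′ (f , partition) = coalition-upper-bound-complete f (m≤n⇒m≤1+n k≤n) partition
  m+k≡n+2 : m + k ≡ suc n + 2
  m+k≡n+2 = ≤-antisym (upper m has-m) (subst (_≤ m + k) δ+3≡n+2 (proj₂ (proj₂ lower)))
  maximal : ∀ m′ → HasKCoalitionPartition (complete (suc n)) k m′ → m′ ≤ m
  maximal m′ has-m′ = +-cancelʳ-≤ k m′ m (≤-trans (upper m′ has-m′) (≤-reflexive (sym m+k≡n+2)))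

theorem2p1 :
    ((n k : ℕ) → 2 ≤ n → 2 ≤ k → (G : Graph n) →
      ∃[ m ] (HasKCoalitionPartition G k m × δ G + 3 ≤ m + k))
    ×
    ((n k : ℕ) → 2 ≤ k → k + 1 ≤ n →
      ∃[ m ] (HasKCoalitionPartition (complete n) k m
              × (∀ m′ → HasKCoalitionPartition (complete n) k m′ → m′ ≤ m)
              × m + k ≡ δ (complete n) + 3
              × m + k ≡ n + 2))
theorem2p1 = coalition-lower-bound , complete-coalition-number
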